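{- Let $p$ be a prime. Then $\ell(p)\leqslant p-1$.
   Context: For an integer $b\geqslant 2$ and a set $S\subseteq \{0,1,\dots,b-1\}$, the Kempner set $\mathcal{K}(S,b)$ is the set of non-negative integers whose base-$b$ expansions use only digits from $S$. It is called proper if $0\in S$ and $S\neq\{0,1,\dots,b-1\}$. $\ell(b)$ denotes the length (number of terms) of the longest arithmetic progression (with nonzero common difference) contained in some proper Kempner set of base $b$. -}

module Defs where

open import Data.Nat using (ℕ; zero; suc; _+_; _*_; _<_; NonZero)
open import Data.Nat.DivMod using (_/_; _%_; m%n<n)
open import Data.Fin using (Fin; fromℕ<) renaming (zero to fzero)
open import Data.Empty using (⊥)
open import Data.Fin.Subset using (Subset; _∈_; _∉_; ⊤)
open import Data.Fin.Subset.Properties using ()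
open import Data.Product using (_×_)
open import Relation.Binary.PropositionalEquality using (_≡_; _≢_)

lastDigit : (b : ℕ) .{{_ : NonZero b}} → ℕ → Fin b
lastDigit b n = fromℕ< (m%n<n n b)

-- InKempner S b n : n belongs to the Kempner set K(S,b), i.e. every digit of the
-- base-b expansion of n lies in S.  The number 0 has the empty expansion.
data InKempner {b : ℕ} .{{_ : NonZero b}} (S : Subset b) : ℕ → Set where
  zeroK : InKempner S 0
  stepK : ∀ {n} → NonZero n → lastDigit b n ∈ S → InKempner S (n / b) → InKempner S n

Proper : {b : ℕ} → Subset b → Set
Proper {zero} S = ⊥
Proper {suc b} S = (fzero ∈ S) × (S ≢ ⊤)

APIn : {b : ℕ} .{{_ : NonZero b}} → Subset b → ℕ → ℕ → ℕ → Set
APIn S a d L = ∀ i → i < L → InKempner S (a + i * d)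

{-# OPTIONS --safe #-}
-- If p ∤ d, the last base-p digits of a, a + d, …, a + (p−1)d are pairwise
-- distinct since p is prime, so they exhaust all p digits; an AP of length p in a
-- Kempner set would therefore force S to contain every digit.  If p ∣ d, dropping
-- the last digit of every term yields an AP with difference d / p inside the
-- same Kempner set, and we recurse.
module Submission where

open import Defs
open import Data.Nat using (ℕ; _+_; _*_; _∸_; _≤_; _<_; NonZero)
open import Data.Nat.Primality using (Prime)
open import Data.Fin.Subset using (Subset)
open import Relation.Binary.PropositionalEquality using (_≢_)

open import Data.Nat using (suc; _≤?_; ≢-nonZero; nonTrivial⇒n>1)
open import Data.Nat.Properties
open import Data.Nat.DivMod
open import Data.Nat.Divisibility using (_∣_; _∣?_; divides; ∣⇒≤; ∣m+n∣m⇒∣n; ∣n⇒∣m*n; n∣m*n)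
open import Data.Nat.Induction using (<-wellFounded)
open import Data.Nat.Primality using (euclidsLemma; prime⇒nonTrivial)
open import Data.Fin using (Fin; toℕ; punchOut)
open import Data.Fin.Properties using (toℕ-injective; toℕ-fromℕ<; toℕ<n; punchOut-injective; injective⇒≤)
open import Data.Fin.Subset using (_∈_; ⊤)
open import Data.Fin.Subset.Properties using (_∈?_; ⊆⊤; ⊆-antisym)
open import Data.Product using (_,_)
open import Data.Sum using (inj₁; inj₂)
open import Data.Empty using (⊥-elim)
open import Function.Definitions using (Injective)
open import Induction.WellFounded using (Acc; acc)
open import Relation.Nullary using (¬_; yes; no; contradiction)
open import Relation.Binary using (tri<; tri≈; tri>)
open import Relation.Binary.PropositionalEquality using (_≡_; refl; sym; trans; cong; subst; module ≡-Reasoning)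

all∈⇒≡⊤ : ∀ {n} {S : Subset n} → (∀ x → x ∈ S) → S ≡ ⊤
all∈⇒≡⊤ all∈ = ⊆-antisym ⊆⊤ (λ {x} _ → all∈ x)

injective⇒¬missing : ∀ {n} {f : Fin n → Fin n} → Injective _≡_ _≡_ f →
                     ∀ y → ¬ (∀ x → f x ≢ y)
injective⇒¬missing {suc n} {f} f-inj y f≢y =
  contradiction (injective⇒≤ punchOut∘f-injective) (<-irrefl refl)
  where
  y≢f : ∀ x → y ≢ f x
  y≢f x y≡fx = f≢y x (sym y≡fx)
  punchOut∘f-injective : Injective _≡_ _≡_ (λ x → punchOut (y≢f x))
  punchOut∘f-injective {x} {x′} eq = f-inj (punchOut-injective (y≢f x) (y≢f x′) eq)

m%o≡[m+n]%o⇒o∣n : ∀ m n o .{{_ : NonZero o}} → m % o ≡ (m + n) % o → o ∣ n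
m%o≡[m+n]%o⇒o∣n m n o eq = ∣m+n∣m⇒∣n (divides ((m + n) / o) shifted) (n∣m*n (m / o))
  where
  open ≡-Reasoning
  shifted : m / o * o + n ≡ (m + n) / o * o
  shifted = +-cancelˡ-≡ (m % o) _ _ (begin
    m % o + (m / o * o + n)        ≡⟨ +-assoc (m % o) _ n ⟨
    m % o + m / o * o + n          ≡⟨ cong (_+ n) (m≡m%n+[m/n]*n m o) ⟨
    m + n                          ≡⟨ m≡m%n+[m/n]*n (m + n) o ⟩
    (m + n) % o + (m + n) / o * o  ≡⟨ cong (_+ (m + n) / o * o) eq ⟨
    m % o + (m + n) / o * o        ∎)

module _ {p : ℕ} .{{_ : NonZero p}} (p-prime : Prime p) {d : ℕ} (p∤d : ¬ p ∣ d) (a : ℕ) where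

  AP-%-distinct : ∀ {i j} → i < j → j < p → (a + i * d) % p ≢ (a + j * d) % p
  AP-%-distinct {i} {j} i<j j<p eq with euclidsLemma (j ∸ i) d p-prime p∣gap
    where
    open ≡-Reasoning
    p∣gap : p ∣ (j ∸ i) * d
    p∣gap = m%o≡[m+n]%o⇒o∣n (a + i * d) ((j ∸ i) * d) p (trans eq (cong (_% p) (begin
      a + j * d                    ≡⟨ cong (λ k → a + k * d) (m+[n∸m]≡n (<⇒≤ i<j)) ⟨
      a + (i + (j ∸ i)) * d        ≡⟨ cong (a +_) (*-distribʳ-+ d i (j ∸ i)) ⟩
      a + (i * d + (j ∸ i) * d)    ≡⟨ +-assoc a (i * d) _ ⟨
      a + i * d + (j ∸ i) * d      ∎)))
  ... | inj₂ p∣d   = p∤d p∣d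
  ... | inj₁ p∣j∸i = <-irrefl refl (begin-strict
    p      ≤⟨ ∣⇒≤ {{≢-nonZero (m>n⇒m∸n≢0 i<j)}} p∣j∸i ⟩
    j ∸ i  ≤⟨ m∸n≤m j i ⟩
    j      <⟨ j<p ⟩
    p      ∎)
    where open ≤-Reasoning

  AP-%-injective : ∀ {i j} → i < p → j < p → (a + i * d) % p ≡ (a + j * d) % p → i ≡ j
  AP-%-injective {i} {j} i<p j<p eq with <-cmp i j
  ... | tri< i<j _ _ = contradiction eq (AP-%-distinct i<j j<p)
  ... | tri≈ _ i≡j _ = i≡j
  ... | tri> _ _ j<i = contradiction (sym eq) (AP-%-distinct j<i i<p)

module _ {b : ℕ} .{{_ : NonZero b}} {S : Subset b} where

  InKempner-/ : ∀ {n} → InKempner S n → InKempner S (n / b)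
  InKempner-/ zeroK          = subst (InKempner S) (sym (0/n≡0 b)) zeroK
  InKempner-/ (stepK _ _ n/b) = n/b

  lastDigit∈ : lastDigit b 0 ∈ S → ∀ {n} → InKempner S n → lastDigit b n ∈ S
  lastDigit∈ 0∈S zeroK          = 0∈S
  lastDigit∈ 0∈S (stepK _ n₀∈S _) = n₀∈S

  APIn-/ : ∀ {a d L} → b ∣ d → APIn S a d L → APIn S (a / b) (d / b) L
  APIn-/ {a} {d} b∣d ap i i<L = subst (InKempner S) quotient-eq (InKempner-/ (ap i i<L))
    where
    open ≡-Reasoning
    quotient-eq : (a + i * d) / b ≡ a / b + i * (d / b)
    quotient-eq = begin
      (a + i * d) / b    ≡⟨ +-distrib-/-∣ʳ a (∣n⇒∣m*n i b∣d) ⟩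
      a / b + i * d / b  ≡⟨ cong (a / b +_) (*-/-assoc i b∣d) ⟩
      a / b + i * (d / b) ∎

  APIn-≤ : ∀ {a d L L′} → L′ ≤ L → APIn S a d L → APIn S a d L′
  APIn-≤ L′≤L ap i i<L′ = ap i (<-≤-trans i<L′ L′≤L)

module _ {p : ℕ} .{{_ : NonZero p}} (p-prime : Prime p) {S : Subset p} (0∈S : lastDigit p 0 ∈ S) where

  coprimeAP⇒all∈ : ∀ {a d} → ¬ p ∣ d → APIn S a d p → ∀ c → c ∈ S
  coprimeAP⇒all∈ {a} {d} p∤d ap c with c ∈? S
  ... | yes c∈S = c∈S
  ... | no  c∉S = ⊥-elim (injective⇒¬missing digit-injective c
                            (λ i digit≡c → c∉S (subst (_∈ S) digit≡c (digit∈S i))))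
    where
    digit : Fin p → Fin p
    digit i = lastDigit p (a + toℕ i * d)

    digit∈S : ∀ i → digit i ∈ S
    digit∈S i = lastDigit∈ 0∈S (ap (toℕ i) (toℕ<n i))

    digit-injective : Injective _≡_ _≡_ digit
    digit-injective {i} {j} eq = toℕ-injective (AP-%-injective p-prime p∤d a (toℕ<n i) (toℕ<n j)
      (trans (sym (toℕ-fromℕ< _)) (trans (cong toℕ eq) (toℕ-fromℕ< _))))

  AP⇒all∈ : ∀ {a d} → d ≢ 0 → APIn S a d p → ∀ c → c ∈ S
  AP⇒all∈ {d = d} d≢0 = go d (<-wellFounded d) d≢0
    where
    go : ∀ {a} d → Acc _<_ d → d ≢ 0 → APIn S a d p → ∀ c → c ∈ S
    go d (acc smaller) d≢0 ap with p ∣? d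
    ... | no  p∤d = coprimeAP⇒all∈ p∤d ap
    ... | yes p∣d = go (d / p) (smaller d/p<d) d/p≢0 (APIn-/ p∣d ap)
      where
      instance _ = ≢-nonZero d≢0
      d/p<d : d / p < d
      d/p<d = m/n<m d p (nonTrivial⇒n>1 p {{prime⇒nonTrivial p-prime}})
      d/p≢0 : d / p ≢ 0
      d/p≢0 d/p≡0 = <⇒≱ (m/n≡0⇒m<n d/p≡0) (∣⇒≤ p∣d)

proposition2p2 : (p : ℕ) → Prime p → .{{_ : NonZero p}} → (S : Subset p) → Proper S →
                   (a d L : ℕ) → d ≢ 0 → APIn S a d L → L ≤ p ∸ 1
proposition2p2 (suc q) p-prime S (0∈S , S≢⊤) a d L d≢0 ap with L ≤? q
... | yes L≤q = L≤q
... | no  L≰q = contradiction (all∈⇒≡⊤ (AP⇒all∈ p-prime 0∈S d≢0 (APIn-≤ (≰⇒> L≰q) ap))) S≢⊤
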